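{- Let $F$ be a forest on $n$ vertices in which every vertex has degree congruent to $1$ modulo $3$, with $3\mid e(F)$, and which is not a matching. Then $R(F,\mathbb{Z}_3)\le n+2$.
   Context: For a graph $G$ with $3\mid e(G)$, $R(G,\mathbb{Z}_3)$ is the least integer $N$ such that for every edge-coloring $\chi: E(K_N)\to\mathbb{Z}_3$ there is a subgraph of $K_N$ isomorphic to $G$ whose edge colors sum to $0$ in $\mathbb{Z}_3$. -}

module Defs where

open import Data.Nat using (ℕ; zero; suc; _+_; _≤_; _<_; _<ᵇ_)
open import Data.Nat.DivMod using (_%_)
open import Data.Bool using (Bool; true; false; if_then_else_; _∧_)
open import Data.Fin using (Fin; toℕ)
open import Data.List using (List; []; _∷_; concatMap; length; map; allFin)
open import Data.Nat.ListAction using (sum)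
open import Data.Product using (_×_; _,_; Σ; proj₁; proj₂)
open import Function.Definitions using (Injective)
open import Relation.Binary.PropositionalEquality using (_≡_)
open import Relation.Nullary using (¬_)

record Graph (n : ℕ) : Set where
  field
    adj   : Fin n → Fin n → Bool
    sym   : ∀ i j → adj i j ≡ adj j i
    irrefl : ∀ i → adj i i ≡ false
open Graph public

degree : ∀ {n} → Graph n → Fin n → ℕ
degree {n} G i = sum (map (λ j → if adj G i j then 1 else 0) (allFin n))
edges : ∀ {n} → Graph n → List (Fin n × Fin n)
edges {n} G = concatMap (λ i → concatMap (λ j →
  if (toℕ i <ᵇ toℕ j) ∧ adj G i j then (i , j) ∷ [] else []) (allFin n)) (allFin n)

e : ∀ {n} → Graph n → ℕ
e G = length (edges G)

record Cycle {n : ℕ} (G : Graph n) : Set where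
  field
    len      : ℕ
    len≥3    : 3 ≤ len
    vert     : Fin len → Fin n
    distinct : Injective _≡_ _≡_ vert
    step     : ∀ (a b : Fin len) → suc (toℕ a) ≡ toℕ b → adj G (vert a) (vert b) ≡ true
    close    : ∀ (a b : Fin len) → suc (toℕ a) ≡ len → toℕ b ≡ 0 → adj G (vert a) (vert b) ≡ true

IsForest : ∀ {n} → Graph n → Set
IsForest G = ¬ Cycle G

IsMatching : ∀ {n} → Graph n → Set
IsMatching G = ∀ i → degree G i ≤ 1

-- An edge-colouring of K_N with colours in ℤ_3 (represented by Fin 3),
-- symmetric so that it is a function of the unordered edge.
record Colouring (N : ℕ) : Set where
  field
    col    : Fin N → Fin N → Fin 3
    colSym : ∀ i j → col i j ≡ col j i
open Colouring public

copySum : ∀ {n N} → Graph n → Colouring N → (Fin n → Fin N) → ℕ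
copySum G χ φ = sum (map (λ ij → toℕ (col χ (φ (proj₁ ij)) (φ (proj₂ ij)))) (edges G)) % 3

ZeroSumProperty : ∀ {n} → Graph n → ℕ → Set
ZeroSumProperty {n} G N = (χ : Colouring N) →
  Σ (Fin n → Fin N) λ φ → Injective _≡_ _≡_ φ × copySum G χ φ ≡ 0

-- R(G, ℤ_3) ≤ M  :⇔  the least N with the zero-sum property is ≤ M,
-- i.e. some N ≤ M has the property.
RZ3≤ : ∀ {n} → Graph n → ℕ → Set
RZ3≤ G M = Σ ℕ λ N → N ≤ M × ZeroSumProperty G N

-- Induction on a vertex set A of the forest such that every vertex of F[A] has degree 1 mod 3
-- and 3 divides |A|: F[A] then has a zero-sum copy in every ℤ₃-colouring of a complete graph
-- on at least |A| + 2 vertices.  If some vertex of F[A] has degree at least 2 (hence at least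
-- 4), acyclicity gives a vertex with three pendant leaves.  Embed F[A] without these leaves.  Otherwise F[A] is a perfect matching with at
-- least three edges: embed all but three of them and place those on the at least eight unused
-- vertices, since every ℤ₃-colouring of K₈ has three disjoint edges with zero colour sum (a
-- finite search).  Colours are summed over ordered pairs of adjacent vertices, i.e. every edge
-- twice, which does not affect divisibility by 3 and makes the removal of a vertex symmetric.

module Submission where

open import Defs hiding (sym)

open import Data.Bool using (Bool; true; false; T; not; _∧_; _∨_; if_then_else_)
open import Data.Bool.ListAction using (any; all)
open import Data.Bool.Properties using (T-∧; T-∨; T-≡; if-∧; ∧-zeroʳ; ∧-assoc; ∧-comm)
open import Data.Empty using (⊥-elim)
open import Data.Fin using (Fin; zero; suc; toℕ; punchIn; fromℕ<; #_)
open import Data.Fin.Properties as Fin using (_≟_; any?; punchInᵢ≢i)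
open import Level using (0ℓ)
open import Relation.Binary using (Rel; Decidable; Symmetric)
open import Relation.Binary.Definitions using (tri<; tri≈; tri>)
open import Data.Nat using (ℕ; zero; suc; _+_; _*_; _∸_; _≤_; _<_; _<ᵇ_; z≤n; s≤s; NonZero)
open import Data.Nat.Induction using (<-rec)
open import Data.Nat.Properties
  using ( +-0-commutativeMonoid; ≤-refl; ≤-reflexive; _≤?_; ≤-trans; ≤-pred; ≰⇒>; <⇒≤; ≤-<-trans; n<1+n
        ; +-cancelʳ-≤; +-monoˡ-≤; m≤n+m; m≤m+n; m∸n≤m; m<n⇒0<n∸m; m+[n∸m]≡n; <⇒<ᵇ; <ᵇ⇒<
        ; +-suc; +-assoc; +-comm; +-identityʳ; suc-injective )
open import Algebra.Properties.CommutativeMonoid.Sum +-0-commutativeMonoid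
  using (sum; sum-syntax; sum-cong-≗; sum-remove; sum-replicate-zero; ∑-distrib-+; ∑-comm)
open import Data.List as List using (List; []; _∷_; _++_; filter)
open import Data.List.Membership.Propositional.Properties using (∈-allFin)
open import Data.List.Relation.Unary.All as All using (All; []; _∷_)
open import Data.List.Relation.Unary.All.Properties using (all⁺; all-filter; filter⁺)
open import Data.List.Relation.Unary.Any.Properties using (any⁻)
open import Data.List.Properties using (map-++)
open import Data.Nat.Coprimality using (coprime?; coprime-divisor)
open import Data.Nat.Divisibility using (_∣_; _∣?_; divides; _∣0; ∣m∣n⇒∣m+n; ∣m+n∣m⇒∣n; n∣m⇒m%n≡0; m%n≡0⇒n∣m)
open import Data.Nat.DivMod using (_%_; %-distribˡ-+; [m+n]%n≡m%n)
open import Data.Nat.ListAction using () renaming (sum to listSum)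
open import Data.Nat.ListAction.Properties using (sum-++)
open import Data.Product using (Σ; ∃; _×_; _,_; proj₁; proj₂)
open import Data.Sum using (_⊎_; inj₁; inj₂)
open import Data.Vec.Functional as Vector using (removeAt; updateAt)
open import Data.Vec.Functional.Properties using (updateAt-updates; updateAt-minimal)
open import Function using (_∘_; _$_; id; Equivalence)
open import Function.Definitions using (Injective)
open import Relation.Binary.PropositionalEquality
  using (_≡_; _≢_; _≗_; refl; sym; trans; cong; cong₂; subst; subst₂; module ≡-Reasoning)
open import Relation.Nullary using (¬_; Dec; yes; no; does; contradiction)
open import Relation.Nullary.Decidable using (T?; toWitness; isYes≗does; map′; _×-dec_; ¬?; decidable-stable)
import Relation.Unary as U

private variable
  k m : ℕ

Subset : ℕ → Set
Subset m = Fin m → Bool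

infix 4 _∈_ _∉_
infixl 5 _─_ _∩_

-- Membership, sums over subsets and several constructions below are opaque: this keeps the
-- subset inferable from `i ∈ P` and `∑⟨ P ⟩ f`, and stops the type checker from unfolding them.
opaque
  _∈_ : Fin m → Subset m → Set
  i ∈ P = T (P i)

_∉_ : Fin m → Subset m → Set
i ∉ P = ¬ i ∈ P

_─_ : Subset m → Fin m → Subset m
(P ─ x) i = if does (i ≟ x) then false else P i

_∩_ : Subset m → Subset m → Subset m
(P ∩ Q) i = P i ∧ Q i

∁ : Subset m → Subset m
∁ P i = not (P i)

full : Subset m
full _ = true

fromDec : ∀ {Q : Fin m → Set} → U.Decidable Q → Subset m
fromDec Q? i = does (Q? i)

─-∩ : ∀ (P Q : Subset m) x → (P ∩ Q) ─ x ≗ (P ─ x) ∩ Q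
─-∩ P Q x i with does (i ≟ x)
... | true  = refl
... | false = refl

opaque
  unfolding _∈_

  ∈-─⁺ : ∀ {P : Subset m} {x i} → i ∈ P → i ≢ x → i ∈ P ─ x
  ∈-─⁺ {x = x} {i} i∈P i≢x with i ≟ x
  ... | yes i≡x = contradiction i≡x i≢x
  ... | no _    = i∈P

  ∈-─⁻ : ∀ {P : Subset m} {x i} → i ∈ P ─ x → i ∈ P × i ≢ x
  ∈-─⁻ {x = x} {i} i∈P─x with i ≟ x
  ... | no i≢x = i∈P─x , i≢x

  x∉P─x : ∀ (P : Subset m) x → x ∉ P ─ x
  x∉P─x P x x∈P─x = proj₂ (∈-─⁻ {P = P} x∈P─x) refl

  ≡true⇒∈ : ∀ {P : Subset m} {i} → P i ≡ true → i ∈ P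
  ≡true⇒∈ Pi≡true = subst T (sym Pi≡true) _

  ∈⇒≡true : ∀ {P : Subset m} {i} → i ∈ P → P i ≡ true
  ∈⇒≡true = Equivalence.to T-≡

  ∈-∩⁺ : ∀ {P Q : Subset m} {i} → i ∈ P → i ∈ Q → i ∈ P ∩ Q
  ∈-∩⁺ i∈P i∈Q = Equivalence.from T-∧ (i∈P , i∈Q)

  ∈-∩⁻ : ∀ {P Q : Subset m} {i} → i ∈ P ∩ Q → i ∈ P × i ∈ Q
  ∈-∩⁻ = Equivalence.to T-∧

  ∈-∁⁻ : ∀ {P : Subset m} {i} → i ∈ ∁ P → i ∉ P
  ∈-∁⁻ {P = P} {i} i∈∁P with P i
  ... | false = λ ()

  ∈-fromDec⁺ : ∀ {Q : Fin m → Set} {Q? : U.Decidable Q} {i} → Q i → i ∈ fromDec Q?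
  ∈-fromDec⁺ {Q? = Q?} {i} qi with Q? i
  ... | yes _  = _
  ... | no ¬qi = ¬qi qi

  ∈-fromDec⁻ : ∀ {Q : Fin m → Set} {Q? : U.Decidable Q} {i} → i ∈ fromDec Q? → Q i
  ∈-fromDec⁻ {Q? = Q?} {i} i∈Q with Q? i
  ... | yes qi = qi

  ∈-full : ∀ {i : Fin m} → i ∈ full
  ∈-full = _

  _∈?_ : ∀ i (P : Subset m) → Dec (i ∈ P)
  i ∈? P = T? (P i)

  if-∈ : ∀ {P : Subset m} {i} {A : Set} {u v : A} → i ∈ P → (if P i then u else v) ≡ u
  if-∈ {P = P} {i} i∈P with P i
  ... | true = refl

  if-∉ : ∀ {P : Subset m} {i} {A : Set} {u v : A} → i ∉ P → (if P i then u else v) ≡ v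
  if-∉ {P = P} {i} i∉P with P i
  ... | false = refl
  ... | true  = contradiction _ i∉P

opaque
  ∑⟨_⟩ : Subset m → (Fin m → ℕ) → ℕ
  ∑⟨ P ⟩ f = sum (λ i → if P i then f i else 0)

size : Subset m → ℕ
size P = ∑⟨ P ⟩ (λ _ → 1)

infixl 5 _∖_

opaque
  _∖_ : Subset m → (Fin k → Fin m) → Subset m
  _∖_ {k = zero}  P xs = P
  _∖_ {k = suc k} P xs = (P ─ xs zero) ∖ (xs ∘ suc)

private variable
  P : Subset m
  f g : Fin m → ℕ
  i x : Fin m

opaque
  unfolding ∑⟨_⟩ _∈_

  ∑⟨⟩-cong : (∀ {i} → i ∈ P → f i ≡ g i) → ∑⟨ P ⟩ f ≡ ∑⟨ P ⟩ g
  ∑⟨⟩-cong {P = P} {f} {g} f≗g = sum-cong-≗ pointwise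
    where
    pointwise : ∀ i → (if P i then f i else 0) ≡ (if P i then g i else 0)
    pointwise i with P i in Pi
    ... | true  = f≗g (subst T (sym Pi) _)
    ... | false = refl

  ∑⟨⟩-congˡ : ∀ {Q : Subset m} → P ≗ Q → ∑⟨ P ⟩ f ≡ ∑⟨ Q ⟩ f
  ∑⟨⟩-congˡ {f = f} P≗Q = sum-cong-≗ λ i → cong (λ b → if b then f i else 0) (P≗Q i)

  ∑⟨⟩-+ : ∑⟨ P ⟩ (λ i → f i + g i) ≡ ∑⟨ P ⟩ f + ∑⟨ P ⟩ g
  ∑⟨⟩-+ {P = P} {f} {g} = trans (sum-cong-≗ pointwise) (∑-distrib-+ (λ i → if P i then f i else 0) _)
    where
    pointwise : ∀ i → (if P i then f i + g i else 0) ≡ (if P i then f i else 0) + (if P i then g i else 0)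
    pointwise i with P i
    ... | true  = refl
    ... | false = refl

  ∑⟨⟩-if : ∀ {Q : Subset m} → ∑⟨ P ⟩ (λ i → if Q i then f i else 0) ≡ ∑⟨ P ∩ Q ⟩ f
  ∑⟨⟩-if {P = P} = sum-cong-≗ λ i → sym (if-∧ (P i))

  ∑⟨⟩-partition : ∀ Q → ∑⟨ P ⟩ f ≡ ∑⟨ P ∩ Q ⟩ f + ∑⟨ P ∩ ∁ Q ⟩ f
  ∑⟨⟩-partition {P = P} {f} Q = trans (sum-cong-≗ pointwise) (∑-distrib-+ (λ i → if (P ∩ Q) i then f i else 0) _)
    where
    pointwise : ∀ i → (if P i then f i else 0) ≡ (if (P ∩ Q) i then f i else 0) + (if (P ∩ ∁ Q) i then f i else 0)
    pointwise i with P i | Q i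
    ... | true  | true  = sym (+-identityʳ _)
    ... | true  | false = refl
    ... | false | _     = refl

  ∑⟨full⟩ : ∑⟨ full ⟩ f ≡ sum f
  ∑⟨full⟩ = refl

  ∑⟨full∩⟩ : ∀ {Q : Subset m} → ∑⟨ full ∩ Q ⟩ f ≡ sum (λ i → if Q i then f i else 0)
  ∑⟨full∩⟩ = refl

  size-full : size (full {m}) ≡ m
  size-full {zero}  = refl
  size-full {suc m} = cong suc (size-full {m})

  ∑⟨⟩-empty : ∀ {m} {P : Subset m} {f} → (∀ i → i ∉ P) → ∑⟨ P ⟩ f ≡ 0
  ∑⟨⟩-empty {m} {P} none = trans (sum-cong-≗ λ i → if-∉ {P = P} (none i)) (sum-replicate-zero m)

  ∑⟨⟩-split : ∀ {m} {P : Subset m} {f : Fin m → ℕ} x → ∑⟨ P ⟩ f ≡ (if P x then f x else 0) + ∑⟨ P ─ x ⟩ f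
  ∑⟨⟩-split {m = suc m} {P = P} {f} x = begin
    sum t                          ≡⟨ sum-remove {i = x} t ⟩
    t x + sum (removeAt t x)       ≡⟨ cong (t x +_) (sum-cong-≗ away-from-x) ⟨
    t x + sum (removeAt t─x x)     ≡⟨ cong (λ z → t x + (z + sum (removeAt t─x x))) t─x-vanishes-at-x ⟨
    t x + (t─x x + sum (removeAt t─x x)) ≡⟨ cong (t x +_) (sum-remove {i = x} t─x) ⟨
    t x + sum t─x                  ∎
    where
    open ≡-Reasoning
    t t─x : Fin (suc m) → ℕ
    t i = if P i then f i else 0
    t─x i = if (P ─ x) i then f i else 0
    t─x-vanishes-at-x : t─x x ≡ 0
    t─x-vanishes-at-x with x ≟ x
    ... | yes _   = refl
    ... | no x≢x = contradiction refl x≢x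
    away-from-x : ∀ j → t─x (punchIn x j) ≡ t (punchIn x j)
    away-from-x j with punchIn x j ≟ x
    ... | yes eq = contradiction eq (punchInᵢ≢i x j)
    ... | no _   = refl

∑⟨⟩-remove : x ∈ P → ∑⟨ P ⟩ f ≡ f x + ∑⟨ P ─ x ⟩ f
∑⟨⟩-remove {x = x} {P = P} {f = f} x∈P = trans (∑⟨⟩-split x) (cong (_+ ∑⟨ P ─ x ⟩ f) (if-∈ x∈P))

∑⟨⟩-singleton : x ∈ P → (∀ {i} → i ∈ P → i ≡ x) → ∑⟨ P ⟩ f ≡ f x
∑⟨⟩-singleton {P = P} {f = f} x∈P unique = begin
  ∑⟨ P ⟩ f              ≡⟨ ∑⟨⟩-remove x∈P ⟩
  f _ + ∑⟨ P ─ _ ⟩ f    ≡⟨ cong (f _ +_) (∑⟨⟩-empty λ i i∈P─x → proj₂ (∈-─⁻ i∈P─x) (unique (proj₁ (∈-─⁻ i∈P─x)))) ⟩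
  f _ + 0               ≡⟨ +-identityʳ _ ⟩
  f _                   ∎
  where open ≡-Reasoning

size-remove : x ∈ P → size P ≡ suc (size (P ─ x))
size-remove = ∑⟨⟩-remove

size-nonempty : 0 < size P → ∃ λ x → x ∈ P
size-nonempty {P = P} 0<size with any? (_∈? P)
... | yes found = found
... | no ∄ = contradiction (subst (0 <_) (∑⟨⟩-empty λ i i∈P → ∄ (i , i∈P)) 0<size) λ ()

size≡1⇒unique : size P ≡ 1 → x ∈ P → i ∈ P → i ≡ x
size≡1⇒unique {P = P} {x = x} {i} size≡1 x∈P i∈P with i ≟ x
... | yes i≡x = i≡x
... | no  i≢x = contradiction (trans (sym (size-remove (∈-─⁺ i∈P i≢x))) size-P─x) λ ()
  where
  size-P─x : size (P ─ x) ≡ 0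
  size-P─x = suc-injective (trans (sym (size-remove x∈P)) size≡1)

∷-injective : ∀ {A : Set} {x : A} {xs : Fin k → A} → (∀ a → xs a ≢ x) → Injective _≡_ _≡_ xs →
              Injective _≡_ _≡_ (x Vector.∷ xs)
∷-injective xs≢x xs-injective {zero}  {zero}  _  = refl
∷-injective xs≢x xs-injective {zero}  {suc b} eq = contradiction (sym eq) (xs≢x b)
∷-injective xs≢x xs-injective {suc a} {zero}  eq = contradiction eq (xs≢x a)
∷-injective xs≢x xs-injective {suc a} {suc b} eq = cong suc (xs-injective eq)

opaque
  pick : ∀ k → k ≤ size P → Σ (Fin k → Fin m) λ xs → Injective _≡_ _≡_ xs × (∀ a → xs a ∈ P)
  pick zero    _ = (λ ()) , (λ { {()} }) , (λ ())
  pick {P = P} (suc k) k<size with size-nonempty (≤-trans (s≤s z≤n) k<size)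
  ... | x , x∈P with pick {P = P ─ x} k (≤-pred (subst (suc k ≤_) (size-remove x∈P) k<size))
  ... | xs , xs-injective , xs∈P─x = x Vector.∷ xs , ∷-injective (λ a → proj₂ (∈-─⁻ (xs∈P─x a))) xs-injective , members
    where
    members : ∀ a → (x Vector.∷ xs) a ∈ P
    members zero    = x∈P
    members (suc a) = proj₁ (∈-─⁻ (xs∈P─x a))

tail∈─head : ∀ {xs : Fin (suc k) → Fin m} → Injective _≡_ _≡_ xs → (∀ a → xs a ∈ P) →
             ∀ a → xs (suc a) ∈ P ─ xs zero
tail∈─head injective xs∈P a = ∈-─⁺ (xs∈P (suc a)) λ eq → contradiction (injective eq) λ ()

opaque
  unfolding _∖_

  ∈-∖⁺ : ∀ {xs : Fin k → Fin m} → i ∈ P → (∀ a → i ≢ xs a) → i ∈ P ∖ xs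
  ∈-∖⁺ {k = zero}  i∈P _       = i∈P
  ∈-∖⁺ {k = suc k} i∈P i≢xs = ∈-∖⁺ (∈-─⁺ i∈P (i≢xs zero)) (i≢xs ∘ suc)

  ∈-∖⁻ : ∀ {xs : Fin k → Fin m} → i ∈ P ∖ xs → i ∈ P × (∀ a → i ≢ xs a)
  ∈-∖⁻ {k = zero}  i∈P = i∈P , λ ()
  ∈-∖⁻ {k = suc k} {P = P} i∈P∖xs with ∈-∖⁻ {P = P ─ _} i∈P∖xs
  ... | i∈P─x , i≢xs with ∈-─⁻ {P = P} i∈P─x
  ... | i∈P , i≢x = i∈P , λ { zero → i≢x ; (suc a) → i≢xs a }

  size-∖ : ∀ {xs : Fin k → Fin m} → Injective _≡_ _≡_ xs → (∀ a → xs a ∈ P) → size P ≡ k + size (P ∖ xs)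
  size-∖ {k = zero}  _ _ = refl
  size-∖ {k = suc k} injective xs∈P =
    trans (size-remove (xs∈P zero)) (cong suc (size-∖ (Fin.suc-injective ∘ injective) (tail∈─head injective xs∈P)))

∑⟨∩⟩-remove : ∀ {Q : Subset m} → x ∈ P → ∑⟨ P ∩ Q ⟩ f ≡ (if Q x then f x else 0) + ∑⟨ (P ─ x) ∩ Q ⟩ f
∑⟨∩⟩-remove {x = x} {P} {f} {Q} x∈P = begin
  ∑⟨ P ∩ Q ⟩ f                                          ≡⟨ ∑⟨⟩-split x ⟩
  (if P x ∧ Q x then f x else 0) + ∑⟨ (P ∩ Q) ─ x ⟩ f
    ≡⟨ cong₂ _+_ (trans (if-∧ (P x)) (if-∈ x∈P)) (∑⟨⟩-congˡ (─-∩ P Q x)) ⟩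
  (if Q x then f x else 0) + ∑⟨ (P ─ x) ∩ Q ⟩ f         ∎
  where open ≡-Reasoning

∑-ones : ∑[ a < k ] 1 ≡ k
∑-ones {k} = trans (sym ∑⟨full⟩) (size-full {k})

size≡0⇒empty : size P ≡ 0 → ∀ i → i ∉ P
size≡0⇒empty size≡0 i i∈P = contradiction (trans (sym (size-remove i∈P)) size≡0) λ ()

listSum-tabulate : ∀ {A : Set} (h : Fin m → A) (g : A → ℕ) → listSum (List.map g (List.tabulate h)) ≡ sum (g ∘ h)
listSum-tabulate {zero}  h g = refl
listSum-tabulate {suc m} h g = cong (g (h zero) +_) (listSum-tabulate (h ∘ suc) g)

listSum-concatMap : ∀ {A B : Set} (g : B → ℕ) (h : A → List B) xs →
                    listSum (List.map g (List.concatMap h xs)) ≡ listSum (List.map (listSum ∘ List.map g ∘ h) xs)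
listSum-concatMap g h []       = refl
listSum-concatMap g h (x ∷ xs) = begin
  listSum (List.map g (h x ++ List.concatMap h xs))                ≡⟨ cong listSum (map-++ g (h x) _) ⟩
  listSum (List.map g (h x) ++ List.map g (List.concatMap h xs))   ≡⟨ sum-++ (List.map g (h x)) _ ⟩
  listSum (List.map g (h x)) + listSum (List.map g (List.concatMap h xs))
    ≡⟨ cong (listSum (List.map g (h x)) +_) (listSum-concatMap g h xs) ⟩
  listSum (List.map g (h x)) + listSum (List.map (listSum ∘ List.map g ∘ h) xs) ∎
  where open ≡-Reasoning

listSum-allFin : ∀ (g : Fin m → ℕ) → listSum (List.map g (List.allFin m)) ≡ sum g
listSum-allFin = listSum-tabulate id

length≡listSum : ∀ {A : Set} (xs : List A) → List.length xs ≡ listSum (List.map (λ _ → 1) xs)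
length≡listSum []       = refl
length≡listSum (x ∷ xs) = cong suc (length≡listSum xs)

sum-%-cong : ∀ {d} .{{_ : NonZero d}} → (∀ i → f i % d ≡ g i % d) → sum f % d ≡ sum g % d
sum-%-cong {zero}  _   = refl
sum-%-cong {suc m} {f} {g} {d} f≡g = begin
  (f zero + sum (f ∘ suc)) % d                  ≡⟨ %-distribˡ-+ (f zero) _ d ⟩
  (f zero % d + sum (f ∘ suc) % d) % d          ≡⟨ cong₂ (λ a b → (a + b) % d) (f≡g zero) (sum-%-cong (f≡g ∘ suc)) ⟩
  (g zero % d + sum (g ∘ suc) % d) % d          ≡⟨ %-distribˡ-+ (g zero) _ d ⟨
  (g zero + sum (g ∘ suc)) % d                  ∎
  where open ≡-Reasoning

3∣x+x⇒3∣x : ∀ {x} → 3 ∣ x + x → 3 ∣ x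
3∣x+x⇒3∣x {x} 3∣x+x = coprime-divisor (toWitness {a? = coprime? 3 2} _) (subst (3 ∣_) (cong (x +_) (sym (+-identityʳ x))) 3∣x+x)

<ᵇ-true : ∀ {a b} → a < b → (a <ᵇ b) ≡ true
<ᵇ-true a<b = Equivalence.to T-≡ (<⇒<ᵇ a<b)

<ᵇ-false : ∀ {a b} → ¬ a < b → (a <ᵇ b) ≡ false
<ᵇ-false {a} {b} a≮b with a <ᵇ b in a<ᵇb
... | false = refl
... | true  = contradiction (<ᵇ⇒< a b (Equivalence.from T-≡ a<ᵇb)) a≮b

≡1-mod-3∧<2⇒≡1 : ∀ {x} → x % 3 ≡ 1 → ¬ 2 ≤ x → x ≡ 1
≡1-mod-3∧<2⇒≡1 {1}                  _ _   = refl
≡1-mod-3∧<2⇒≡1 {suc (suc x)}        _ 2≰x = contradiction (s≤s (s≤s z≤n)) 2≰x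

≡1-mod-3∧≥2⇒≥4 : ∀ {x} → x % 3 ≡ 1 → 2 ≤ x → 4 ≤ x
≡1-mod-3∧≥2⇒≥4 {1}                       _ (s≤s ())
≡1-mod-3∧≥2⇒≥4 {suc (suc (suc (suc x)))} _ _ = s≤s (s≤s (s≤s (s≤s z≤n)))

does-sound : ∀ {A : Set} (a? : Dec A) → T (does a?) → A
does-sound a? t = toWitness (subst T (sym (isYes≗does a?)) t)

-- A decision tree over ℤ₃-colourings of the keys, coloured in the order of the list: a branch is
-- closed as soon as the newest key completes a zero-sum triple of pairwise apart keys, and
-- `forced [] ks` evaluating to true certifies that every colouring has such a triple.
module ZeroSumSearch {K : Set} {Apart : Rel K 0ℓ} (apart-sym : Symmetric Apart) (apart? : Decidable Apart) where

  record ZeroSumTriple (c : K → Fin 3) : Set where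
    field
      keys : Fin 3 → K
      apart : ∀ {a b} → a ≢ b → Apart (keys a) (keys b)
      zero-sum : 3 ∣ ∑[ a < 3 ] toℕ (c (keys a))

  Assignment : Set
  Assignment = List (K × Fin 3)

  zeroSum? : Fin 3 → Fin 3 → Fin 3 → Bool
  zeroSum? u v w = does (3 ∣? toℕ u + (toℕ v + (toℕ w + 0)))

  completes : K × Fin 3 → Assignment → Bool
  completes (z , w) []            = false
  completes (z , w) ((x , u) ∷ σ) = any (λ (y , v) → zeroSum? u v w ∧ does (apart? x y)) σ ∨ completes (z , w) σ

  closes : K × Fin 3 → Assignment → Bool
  closes (z , w) ρ = completes (z , w) (filter (λ (x , _) → apart? x z) ρ)

  forced : Assignment → List K → Bool
  forced ρ []       = false
  forced ρ (k ∷ ks) = all (λ w → closes (k , w) ρ ∨ forced ((k , w) ∷ ρ) ks) (List.allFin 3)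

  module _ (c : K → Fin 3) where

    Agrees : Assignment → Set
    Agrees = All (λ (k , v) → c k ≡ v)

    triple : ∀ {x y z} → Apart x y → Apart x z → Apart y z →
             T (zeroSum? (c x) (c y) (c z)) → ZeroSumTriple c
    triple {x} {y} {z} xy xz yz zs = record { keys = keys ; apart = apart ; zero-sum = does-sound (3 ∣? _) zs }
      where
      keys : Fin 3 → K
      keys = x Vector.∷ y Vector.∷ z Vector.∷ Vector.[]
      apart : ∀ {a b} → a ≢ b → Apart (keys a) (keys b)
      apart {zero}           {zero}           0≢0 = contradiction refl 0≢0
      apart {zero}           {suc zero}       _   = xy
      apart {zero}           {suc (suc zero)} _   = xz
      apart {suc zero}       {zero}           _   = apart-sym xy
      apart {suc zero}       {suc zero}       1≢1 = contradiction refl 1≢1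
      apart {suc zero}       {suc (suc zero)} _   = yz
      apart {suc (suc zero)} {zero}           _   = apart-sym xz
      apart {suc (suc zero)} {suc zero}       _   = apart-sym yz
      apart {suc (suc zero)} {suc (suc zero)} 2≢2 = contradiction refl 2≢2

    completes-sound : ∀ {z} σ → All (λ (x , u) → c x ≡ u × Apart x z) σ → T (completes (z , c z) σ) → ZeroSumTriple c
    completes-sound {z} ((x , u) ∷ σ) ((cx≡u , xz) ∷ agree) t with Equivalence.to T-∨ t
    ... | inj₂ t′ = completes-sound σ agree t′
    ... | inj₁ t′ with All.lookupAny agree (any⁻ _ σ t′)
    ... | (cy≡v , yz) , hit with Equivalence.to T-∧ hit
    ... | zs , xy = triple (does-sound (apart? x _) xy) xz yz (subst₂ (λ u v → T (zeroSum? u v (c z))) (sym cx≡u) (sym cy≡v) zs)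

    closes-sound : ∀ {z} ρ → Agrees ρ → T (closes (z , c z) ρ) → ZeroSumTriple c
    closes-sound {z} ρ agree = completes-sound _ (All.zip (filter⁺ apart-z? agree , all-filter apart-z? ρ))
      where
      apart-z? = λ ((x , _) : K × Fin 3) → apart? x z

    forced-sound : ∀ ρ ks → Agrees ρ → T (forced ρ ks) → ZeroSumTriple c
    forced-sound ρ (k ∷ ks) agree t with Equivalence.to T-∨ (All.lookup (all⁺ branch (List.allFin 3) t) (∈-allFin (c k)))
      where branch = λ w → closes (k , w) ρ ∨ forced ((k , w) ∷ ρ) ks
    ... | inj₁ closed = closes-sound ρ agree closed
    ... | inj₂ rest   = forced-sound ((k , c k) ∷ ρ) ks (refl ∷ agree) rest

  opaque
    search : ∀ ks → T (forced [] ks) → ∀ c → ZeroSumTriple c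
    search ks t c = forced-sound c [] ks [] t


opaque
  zeroSumTriple : (v : Fin 5 → Fin 3) → Σ (Fin 3 → Fin 5) λ t → Injective _≡_ _≡_ t × 3 ∣ ∑[ a < 3 ] toℕ (v (t a))
  zeroSumTriple v = keys , injective , zero-sum
    where
    open ZeroSumSearch {K = Fin 5} {Apart = _≢_} (λ x≢y → x≢y ∘ sym) (λ x y → ¬? (x ≟ y))
    open ZeroSumTriple (search (List.allFin 5) _ v)
    injective : Injective _≡_ _≡_ keys
    injective {a} {b} eq with a ≟ b
    ... | yes a≡b = a≡b
    ... | no  a≢b = contradiction eq (apart a≢b)

record Disjoint (e e′ : Fin 8 × Fin 8) : Set where
  field
    proper : proj₁ e ≢ proj₂ e
    proper′ : proj₁ e′ ≢ proj₂ e′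
    left≢left : proj₁ e ≢ proj₁ e′
    left≢right : proj₁ e ≢ proj₂ e′
    right≢left : proj₂ e ≢ proj₁ e′
    right≢right : proj₂ e ≢ proj₂ e′

disjoint-sym : Symmetric Disjoint
disjoint-sym d = record
  { proper = proper′ ; proper′ = proper
  ; left≢left = left≢left ∘ sym ; left≢right = right≢left ∘ sym
  ; right≢left = left≢right ∘ sym ; right≢right = right≢right ∘ sym }
  where open Disjoint d

disjoint? : Decidable Disjoint
disjoint? (a , b) (c , d) =
  map′ (λ (ac , ad , bc , bd , ab , cd) → record
         { proper = ab ; proper′ = cd ; left≢left = ac ; left≢right = ad ; right≢left = bc ; right≢right = bd })
       (λ r → let open Disjoint r in left≢left , left≢right , right≢left , right≢right , proper , proper′)
       (¬? (a ≟ c) ×-dec ¬? (a ≟ d) ×-dec ¬? (b ≟ c) ×-dec ¬? (b ≟ d) ×-dec ¬? (a ≟ b) ×-dec ¬? (c ≟ d))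

-- A perfect matching first, then the other edges colexicographically: with this order the
-- search tree has about 1400 nodes, against about 3·10⁵ in colexicographic order.
edgeOrder : List (Fin 8 × Fin 8)
edgeOrder =
  (# 0 , # 1) ∷ (# 2 , # 3) ∷ (# 4 , # 5) ∷ (# 6 , # 7) ∷
  (# 0 , # 2) ∷ (# 1 , # 2) ∷ (# 0 , # 3) ∷ (# 1 , # 3) ∷
  (# 0 , # 4) ∷ (# 1 , # 4) ∷ (# 2 , # 4) ∷ (# 3 , # 4) ∷
  (# 0 , # 5) ∷ (# 1 , # 5) ∷ (# 2 , # 5) ∷ (# 3 , # 5) ∷
  (# 0 , # 6) ∷ (# 1 , # 6) ∷ (# 2 , # 6) ∷ (# 3 , # 6) ∷ (# 4 , # 6) ∷ (# 5 , # 6) ∷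
  (# 0 , # 7) ∷ (# 1 , # 7) ∷ (# 2 , # 7) ∷ (# 3 , # 7) ∷ (# 4 , # 7) ∷ (# 5 , # 7) ∷ []

record ZeroSumMatching (c : Fin 8 → Fin 8 → Fin 3) : Set where
  field
    left right : Fin 3 → Fin 8
    left-injective : Injective _≡_ _≡_ left
    right-injective : Injective _≡_ _≡_ right
    left≢right : ∀ a b → left a ≢ right b
    zero-sum : 3 ∣ ∑[ a < 3 ] toℕ (c (left a) (right a))

opaque
  zeroSumMatching : (c : Fin 8 → Fin 8 → Fin 3) → ZeroSumMatching c
  zeroSumMatching c = record
    { left = proj₁ ∘ keys
    ; right = proj₂ ∘ keys
    ; left-injective = injectiveBy Disjoint.left≢left
    ; right-injective = injectiveBy Disjoint.right≢right
    ; left≢right = left≢right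
    ; zero-sum = zero-sum
    }
    where
    open ZeroSumSearch disjoint-sym disjoint?
    open ZeroSumTriple (search edgeOrder _ (λ (x , y) → c x y))
    injectiveBy : ∀ {f : Fin 8 × Fin 8 → Fin 8} → (∀ {e e′} → Disjoint e e′ → f e ≢ f e′) →
                  Injective _≡_ _≡_ (f ∘ keys)
    injectiveBy distinguishes {a} {b} eq with a ≟ b
    ... | yes a≡b = a≡b
    ... | no  a≢b = contradiction eq (distinguishes (apart a≢b))
    left≢right : ∀ a b → proj₁ (keys a) ≢ proj₂ (keys b)
    left≢right a b with a ≟ b
    ... | yes refl = Disjoint.proper (apart (punchInᵢ≢i a zero ∘ sym))
    ... | no  a≢b  = Disjoint.left≢right (apart a≢b)

3∣⇒0∨3∨≥6 : ∀ {s} → 3 ∣ s → s ≡ 0 ⊎ s ≡ 3 ⊎ 6 ≤ s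
3∣⇒0∨3∨≥6 (divides zero          refl) = inj₁ refl
3∣⇒0∨3∨≥6 (divides (suc zero)    refl) = inj₂ (inj₁ refl)
3∣⇒0∨3∨≥6 (divides (suc (suc q)) refl) = inj₂ (inj₂ (m≤m+n 6 (q * 3)))

colourWeight : ∀ {n N} → Colouring N → (Fin n → Fin N) → Fin n → Fin n → ℕ
colourWeight χ φ i j = toℕ (col χ (φ i) (φ j))

module _ {n} (F : Graph n) where

  private variable
    A : Subset n
    w w′ : Fin n → Fin n → ℕ
    j p : Fin n

  infix 4 _~_

  _~_ : Fin n → Fin n → Set
  i ~ j = j ∈ adj F i

  ~-sym : i ~ j → j ~ i
  ~-sym {i} {j} i~j = ≡true⇒∈ (trans (Graph.sym F j i) (∈⇒≡true i~j))

  ~⇒≢ : i ~ j → i ≢ j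
  ~⇒≢ {i} i~j refl = contradiction (trans (sym (Graph.irrefl F i)) (∈⇒≡true i~j)) λ ()

  deg : Subset n → Fin n → ℕ
  deg A i = size (A ∩ adj F i)

  DegreesOneMod3 : Subset n → Set
  DegreesOneMod3 A = ∀ {i} → i ∈ A → deg A i % 3 ≡ 1

  arcSum : Subset n → (Fin n → Fin n → ℕ) → ℕ
  arcSum A w = ∑⟨ A ⟩ λ i → ∑⟨ A ∩ adj F i ⟩ (w i)

  arcSum-cong : (∀ {i j} → i ∈ A → j ∈ A → w i j ≡ w′ i j) → arcSum A w ≡ arcSum A w′
  arcSum-cong w≡w′ = ∑⟨⟩-cong λ i∈A → ∑⟨⟩-cong λ j∈A∩ → w≡w′ i∈A (proj₁ (∈-∩⁻ j∈A∩))

  deg-─ : x ∈ A → deg A i ≡ (if adj F i x then 1 else 0) + deg (A ─ x) i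
  deg-─ = ∑⟨∩⟩-remove

  arcSum-remove : x ∈ A → arcSum A w ≡ ∑⟨ (A ─ x) ∩ adj F x ⟩ (λ j → w x j + w j x) + arcSum (A ─ x) w
  arcSum-remove {x} {A} {w} x∈A = begin
    arcSum A w
      ≡⟨ ∑⟨⟩-remove x∈A ⟩
    ∑⟨ A ∩ adj F x ⟩ (w x) + ∑⟨ A ─ x ⟩ (λ i → ∑⟨ A ∩ adj F i ⟩ (w i))
      ≡⟨ cong₂ _+_ out-of-x (∑⟨⟩-cong λ i∈A─x → ∑⟨∩⟩-remove x∈A) ⟩
    ∑⟨ N ⟩ (w x) + ∑⟨ A ─ x ⟩ (λ i → (if adj F i x then w i x else 0) + ∑⟨ (A ─ x) ∩ adj F i ⟩ (w i))
      ≡⟨ cong (∑⟨ N ⟩ (w x) +_) ∑⟨⟩-+ ⟩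
    ∑⟨ N ⟩ (w x) + (∑⟨ A ─ x ⟩ (λ i → if adj F i x then w i x else 0) + arcSum (A ─ x) w)
      ≡⟨ cong (λ s → ∑⟨ N ⟩ (w x) + (s + arcSum (A ─ x) w)) (trans ∑⟨⟩-if (∑⟨⟩-congˡ into-x)) ⟩
    ∑⟨ N ⟩ (w x) + (∑⟨ N ⟩ (λ j → w j x) + arcSum (A ─ x) w)
      ≡⟨ +-assoc (∑⟨ N ⟩ (w x)) _ _ ⟨
    ∑⟨ N ⟩ (w x) + ∑⟨ N ⟩ (λ j → w j x) + arcSum (A ─ x) w
      ≡⟨ cong (_+ arcSum (A ─ x) w) ∑⟨⟩-+ ⟨
    ∑⟨ N ⟩ (λ j → w x j + w j x) + arcSum (A ─ x) w
      ∎
    where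
    open ≡-Reasoning
    N = (A ─ x) ∩ adj F x
    out-of-x : ∑⟨ A ∩ adj F x ⟩ (w x) ≡ ∑⟨ N ⟩ (w x)
    out-of-x = trans (∑⟨∩⟩-remove x∈A) (cong (λ b → (if b then w x x else 0) + ∑⟨ N ⟩ (w x)) (Graph.irrefl F x))
    into-x : (A ─ x) ∩ (λ i → adj F i x) ≗ N
    into-x i = cong ((A ─ x) i ∧_) (Graph.sym F i x)

  record Pendant (A : Subset n) (x p : Fin n) : Set where
    field
      leaf∈ : x ∈ A
      adjacent : x ~ p
      unique : ∀ {j} → j ∈ A → x ~ j → j ≡ p

  Pendant-─ : Pendant A x p → x ≢ j → Pendant (A ─ j) x p
  Pendant-─ pendant x≢j = record
    { leaf∈ = ∈-─⁺ leaf∈ x≢j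
    ; adjacent = adjacent
    ; unique = λ i∈A─j → unique (proj₁ (∈-─⁻ i∈A─j))
    }
    where open Pendant pendant

  arcSum-remove-pendant : Pendant A x p → p ∈ A → arcSum A w ≡ (w x p + w p x) + arcSum (A ─ x) w
  arcSum-remove-pendant {A} {x} {p} {w} pendant p∈A =
    trans (arcSum-remove leaf∈) (cong (_+ arcSum (A ─ x) w) (∑⟨⟩-singleton p∈N only-p))
    where
    open Pendant pendant
    p∈N : p ∈ (A ─ x) ∩ adj F x
    p∈N = ∈-∩⁺ (∈-─⁺ p∈A (~⇒≢ adjacent ∘ sym)) adjacent
    only-p : ∀ {j} → j ∈ (A ─ x) ∩ adj F x → j ≡ p
    only-p j∈N = let (j∈A─x , x~j) = ∈-∩⁻ j∈N in unique (proj₁ (∈-─⁻ j∈A─x)) x~j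

  arcSum-remove-isolated : x ∈ A → (∀ {j} → j ∈ A → ¬ x ~ j) → arcSum A w ≡ arcSum (A ─ x) w
  arcSum-remove-isolated {x} {A} {w} x∈A isolated =
    trans (arcSum-remove x∈A) (cong (_+ arcSum (A ─ x) w) (∑⟨⟩-empty no-neighbour))
    where
    no-neighbour : ∀ j → j ∉ _
    no-neighbour j j∈N = let (j∈A─x , x~j) = ∈-∩⁻ j∈N in isolated (proj₁ (∈-─⁻ j∈A─x)) x~j

  opaque
    unfolding _∖_

    deg-∖ : ∀ {xs : Fin k → Fin n} → Injective _≡_ _≡_ xs → (∀ a → xs a ∈ A) →
            deg A i ≡ ∑[ a < k ] (if adj F i (xs a) then 1 else 0) + deg (A ∖ xs) i
    deg-∖ {k = zero}  _ _ = refl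
    deg-∖ {k = suc k} {A} {i} {xs} injective xs∈A = begin
      deg A i                                        ≡⟨ deg-─ (xs∈A zero) ⟩
      [ xs zero ] + deg (A ─ xs zero) i
        ≡⟨ cong ([ xs zero ] +_) (deg-∖ (Fin.suc-injective ∘ injective) (tail∈─head injective xs∈A)) ⟩
      [ xs zero ] + (∑[ a < k ] [ xs (suc a) ] + _)  ≡⟨ +-assoc [ xs zero ] _ _ ⟨
      ∑[ a < suc k ] [ xs a ] + deg (A ∖ xs) i       ∎
      where
      open ≡-Reasoning
      [_] : Fin n → ℕ
      [ x ] = if adj F i x then 1 else 0

    arcSum-∖-pendants : ∀ {xs ps : Fin k → Fin n} → Injective _≡_ _≡_ xs →
                        (∀ a → Pendant A (xs a) (ps a)) → (∀ a → ps a ∈ A ∖ xs) →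
                        arcSum A w ≡ ∑[ a < k ] (w (xs a) (ps a) + w (ps a) (xs a)) + arcSum (A ∖ xs) w
    arcSum-∖-pendants {k = zero}  _ _ _ = refl
    arcSum-∖-pendants {k = suc k} {A} {w} {xs} {ps} injective pendant ps∈A∖xs = begin
      arcSum A w
        ≡⟨ arcSum-remove-pendant (pendant zero) (proj₁ (∈-∖⁻ {xs = xs} (ps∈A∖xs zero))) ⟩
      c zero + arcSum (A ─ xs zero) w
        ≡⟨ cong (c zero +_) (arcSum-∖-pendants (Fin.suc-injective ∘ injective) pendant′ (λ a → ps∈A∖xs (suc a))) ⟩
      c zero + (∑[ a < k ] c (suc a) + _)        ≡⟨ +-assoc (c zero) _ _ ⟨
      ∑[ a < suc k ] c a + arcSum (A ∖ xs) w     ∎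
      where
      open ≡-Reasoning
      c : Fin (suc k) → ℕ
      c a = w (xs a) (ps a) + w (ps a) (xs a)
      pendant′ : ∀ a → Pendant (A ─ xs zero) (xs (suc a)) (ps (suc a))
      pendant′ a = Pendant-─ (pendant (suc a)) λ eq → contradiction (injective eq) λ ()

    arcSum-∖-isolated : ∀ {xs : Fin k → Fin n} → Injective _≡_ _≡_ xs → (∀ a → xs a ∈ A) →
                        (∀ a {j} → j ∈ A → ¬ xs a ~ j) → arcSum A w ≡ arcSum (A ∖ xs) w
    arcSum-∖-isolated {k = zero}  _ _ _ = refl
    arcSum-∖-isolated {k = suc k} injective xs∈A isolated =
      trans (arcSum-remove-isolated (xs∈A zero) (isolated zero))
            (arcSum-∖-isolated (Fin.suc-injective ∘ injective) (tail∈─head injective xs∈A)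
                               λ a j∈A─x → isolated (suc a) (proj₁ (∈-─⁻ j∈A─x)))

  deg-∖-nonadjacent : ∀ {xs : Fin k → Fin n} → Injective _≡_ _≡_ xs → (∀ a → xs a ∈ A) →
                      (∀ a → ¬ i ~ xs a) → deg A i ≡ deg (A ∖ xs) i
  deg-∖-nonadjacent {k = k} {A} {i} {xs} injective xs∈A ≁ = trans (deg-∖ injective xs∈A)
    (cong (_+ deg (A ∖ xs) i) (trans (sum-cong-≗ λ a → if-∉ {P = adj F i} (≁ a)) (sum-replicate-zero k)))

  deg-∖-adjacent : ∀ {xs : Fin k → Fin n} → Injective _≡_ _≡_ xs → (∀ a → xs a ∈ A) →
                   (∀ a → i ~ xs a) → deg A i ≡ k + deg (A ∖ xs) i
  deg-∖-adjacent {k = k} {A} {i} {xs} injective xs∈A ~xs = trans (deg-∖ injective xs∈A)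
    (cong (_+ deg (A ∖ xs) i) (trans (sum-cong-≗ λ a → if-∈ {P = adj F i} (~xs a)) ∑-ones))

  degree≡deg : ∀ v → degree F v ≡ deg full v
  degree≡deg v = trans (listSum-allFin (λ j → if adj F v j then 1 else 0)) (sym ∑⟨full∩⟩)

  ascending : (Fin n → Fin n → ℕ) → ℕ
  ascending w = ∑[ i < n ] ∑[ j < n ] (if (toℕ i <ᵇ toℕ j) ∧ adj F i j then w i j else 0)

  listSum-edges : ∀ (g : Fin n × Fin n → ℕ) → listSum (List.map g (edges F)) ≡ ascending (λ i j → g (i , j))
  listSum-edges g = begin
    listSum (List.map g (edges F))
      ≡⟨ listSum-concatMap g _ (List.allFin n) ⟩
    listSum (List.map (λ i → listSum (List.map g (List.concatMap (cell i) (List.allFin n)))) (List.allFin n))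
      ≡⟨ listSum-allFin (λ i → listSum (List.map g (List.concatMap (cell i) (List.allFin n)))) ⟩
    ∑[ i < n ] listSum (List.map g (List.concatMap (cell i) (List.allFin n)))
      ≡⟨ sum-cong-≗ (λ i → trans (listSum-concatMap g (cell i) (List.allFin n))
                                 (listSum-allFin (λ j → listSum (List.map g (cell i j))))) ⟩
    ∑[ i < n ] ∑[ j < n ] listSum (List.map g (cell i j))
      ≡⟨ sum-cong-≗ (λ i → sum-cong-≗ (λ j → listSum-cell ((toℕ i <ᵇ toℕ j) ∧ adj F i j))) ⟩
    ascending (λ i j → g (i , j))
      ∎
    where
    open ≡-Reasoning
    cell : Fin n → Fin n → List (Fin n × Fin n)
    cell i j = if (toℕ i <ᵇ toℕ j) ∧ adj F i j then (i , j) ∷ [] else []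
    listSum-cell : ∀ {x} b → listSum (List.map g (if b then x ∷ [] else [])) ≡ (if b then g x else 0)
    listSum-cell true  = +-identityʳ _
    listSum-cell false = refl

  arcSum-full : (∀ i j → w i j ≡ w j i) → arcSum full w ≡ ascending w + ascending w
  arcSum-full {w} w-sym = begin
    arcSum full w
      ≡⟨ trans ∑⟨full⟩ (sum-cong-≗ λ i → trans ∑⟨full∩⟩ (sum-cong-≗ (split i))) ⟩
    ∑[ i < n ] ∑[ j < n ] (lower i j + upper i j)
      ≡⟨ sum-cong-≗ (λ i → ∑-distrib-+ (lower i) (upper i)) ⟩
    ∑[ i < n ] (∑[ j < n ] lower i j + ∑[ j < n ] upper i j)
      ≡⟨ ∑-distrib-+ (λ i → ∑[ j < n ] lower i j) _ ⟩
    ascending w + ∑[ i < n ] ∑[ j < n ] upper i j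
      ≡⟨ cong (ascending w +_) (∑-comm upper) ⟩
    ascending w + ∑[ j < n ] ∑[ i < n ] upper i j
      ≡⟨ cong (ascending w +_) (sum-cong-≗ λ j → sum-cong-≗ λ i →
           cong₂ (λ b x → if (toℕ j <ᵇ toℕ i) ∧ b then x else 0) (Graph.sym F i j) (w-sym i j)) ⟩
    ascending w + ascending w
      ∎
    where
    open ≡-Reasoning
    lower upper : Fin n → Fin n → ℕ
    lower i j = if (toℕ i <ᵇ toℕ j) ∧ adj F i j then w i j else 0
    upper i j = if (toℕ j <ᵇ toℕ i) ∧ adj F i j then w i j else 0
    split : ∀ i j → (if adj F i j then w i j else 0) ≡ lower i j + upper i j
    split i j with Fin.<-cmp i j
    ... | tri< i<j _ j≮i rewrite <ᵇ-true i<j | <ᵇ-false j≮i = sym (+-identityʳ _)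
    ... | tri> i≮j _ j<i rewrite <ᵇ-false i≮j | <ᵇ-true j<i = refl
    ... | tri≈ _ refl _  rewrite Graph.irrefl F i | ∧-zeroʳ (toℕ i <ᵇ toℕ i) = refl

  edges≡ascending : e F ≡ ascending (λ _ _ → 1)
  edges≡ascending = trans (length≡listSum (edges F)) (listSum-edges (λ _ → 1))

  handshake : ∑[ v < n ] deg full v ≡ e F + e F
  handshake = begin
    ∑[ v < n ] deg full v                           ≡⟨ ∑⟨full⟩ ⟨
    arcSum full (λ _ _ → 1)                         ≡⟨ arcSum-full (λ _ _ → refl) ⟩
    ascending (λ _ _ → 1) + ascending (λ _ _ → 1)   ≡⟨ cong (λ s → s + s) edges≡ascending ⟨
    e F + e F                                       ∎
    where open ≡-Reasoning

  3∣vertices : (∀ v → degree F v % 3 ≡ 1) → 3 ∣ e F → 3 ∣ n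
  3∣vertices degrees 3∣e = m%n≡0⇒n∣m n 3 (begin
    n % 3                        ≡⟨ cong (_% 3) (trans (sym (size-full {n})) ∑⟨full⟩) ⟩
    (∑[ v < n ] 1) % 3           ≡⟨ sum-%-cong (λ v → sym (trans (cong (_% 3) (sym (degree≡deg v))) (degrees v))) ⟩
    (∑[ v < n ] deg full v) % 3  ≡⟨ cong (_% 3) handshake ⟩
    (e F + e F) % 3              ≡⟨ n∣m⇒m%n≡0 _ 3 (∣m∣n⇒∣m+n 3∣e 3∣e) ⟩
    0                            ∎)
    where open ≡-Reasoning

  copySum≡0 : ∀ {N} (χ : Colouring N) (φ : Fin n → Fin N) → 3 ∣ arcSum full (colourWeight χ φ) → copySum F χ φ ≡ 0
  copySum≡0 χ φ 3∣arcSum =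
    trans (cong (_% 3) (listSum-edges _)) (n∣m⇒m%n≡0 _ 3 (3∣x+x⇒3∣x {ascending (colourWeight χ φ)} 3∣ascending+ascending))
    where
    3∣ascending+ascending : 3 ∣ ascending (colourWeight χ φ) + ascending (colourWeight χ φ)
    3∣ascending+ascending = subst (3 ∣_) (arcSum-full λ i j → cong toℕ (colSym χ (φ i) (φ j))) 3∣arcSum

  record NonBacktrackingWalk : Set where
    field
      vertex : ℕ → Fin n
      adjacent : ∀ t → vertex t ~ vertex (suc t)
      non-backtracking : ∀ t → vertex (suc (suc t)) ≢ vertex t

  module _ (W : NonBacktrackingWalk) where
    open NonBacktrackingWalk W

    injectiveClosedSegment⇒cycle : ∀ s L → 0 < L → vertex s ≡ vertex (s + L) →
                                   Injective _≡_ _≡_ (λ (a : Fin L) → vertex (s + toℕ a)) → Cycle F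
    injectiveClosedSegment⇒cycle s 1 _ closed _ = ⊥-elim $
      ~⇒≢ (adjacent s) (trans closed (cong vertex (trans (+-suc s 0) (cong suc (+-identityʳ s)))))
    injectiveClosedSegment⇒cycle s 2 _ closed _ = ⊥-elim $
      non-backtracking s (sym (trans closed (cong vertex (trans (+-suc s 1) (cong suc (trans (+-suc s 0) (cong suc (+-identityʳ s))))))))
    injectiveClosedSegment⇒cycle s L@(suc (suc (suc _))) _ closed distinct = record
      { len = L
      ; len≥3 = s≤s (s≤s (s≤s z≤n))
      ; vert = λ a → vertex (s + toℕ a)
      ; distinct = distinct
      ; step = λ a b 1+a≡b → ∈⇒≡true (subst (vertex (s + toℕ a) ~_) (cong vertex (trans (sym (+-suc s (toℕ a))) (cong (s +_) 1+a≡b)))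
                                            (adjacent (s + toℕ a)))
      ; close = λ a b 1+a≡L b≡0 → ∈⇒≡true (subst (vertex (s + toℕ a) ~_) (wraps-around a b 1+a≡L b≡0) (adjacent (s + toℕ a)))
      }
      where
      wraps-around : ∀ (a b : Fin L) → suc (toℕ a) ≡ L → toℕ b ≡ 0 → vertex (suc (s + toℕ a)) ≡ vertex (s + toℕ b)
      wraps-around a b 1+a≡L b≡0 = begin
        vertex (suc (s + toℕ a))  ≡⟨ cong vertex (trans (sym (+-suc s _)) (cong (s +_) 1+a≡L)) ⟩
        vertex (s + L)            ≡⟨ closed ⟨
        vertex s                  ≡⟨ cong vertex (trans (sym (+-identityʳ s)) (cong (s +_) (sym b≡0))) ⟩
        vertex (s + toℕ b)        ∎
        where open ≡-Reasoning

    closedSegment⇒cycle : ∀ L s → 0 < L → vertex s ≡ vertex (s + L) → Cycle F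
    closedSegment⇒cycle = <-rec (λ L → ∀ s → 0 < L → vertex s ≡ vertex (s + L) → Cycle F) shortest
      where
      shortest : ∀ L → (∀ {L′} → L′ < L → ∀ s → 0 < L′ → vertex s ≡ vertex (s + L′) → Cycle F) →
                 ∀ s → 0 < L → vertex s ≡ vertex (s + L) → Cycle F
      shortest L shorter s 0<L closed
        with any? (λ (a : Fin L) → any? λ b → (a Fin.<? b) ×-dec (vertex (s + toℕ a) ≟ vertex (s + toℕ b)))
      ... | yes (a , b , a<b , repeat) =
        shorter (≤-<-trans (m∸n≤m (toℕ b) (toℕ a)) (Fin.toℕ<n b)) (s + toℕ a) (m<n⇒0<n∸m a<b)
          (trans repeat (cong vertex (trans (cong (s +_) (sym (m+[n∸m]≡n (<⇒≤ a<b)))) (sym (+-assoc s (toℕ a) _)))))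
      ... | no no-repeat = injectiveClosedSegment⇒cycle s L 0<L closed distinct
        where
        distinct : Injective _≡_ _≡_ (λ (a : Fin L) → vertex (s + toℕ a))
        distinct {a} {b} repeat with Fin.<-cmp a b
        ... | tri< a<b _ _ = contradiction (a , b , a<b , repeat) no-repeat
        ... | tri≈ _ a≡b _ = a≡b
        ... | tri> _ _ b<a = contradiction (b , a , b<a , sym repeat) no-repeat

    walk⇒cycle : Cycle F
    walk⇒cycle with Fin.pigeonhole (n<1+n n) (vertex ∘ toℕ)
    ... | i , j , i<j , repeat =
      closedSegment⇒cycle (toℕ j ∸ toℕ i) (toℕ i) (m<n⇒0<n∸m i<j) (trans repeat (cong vertex (sym (m+[n∸m]≡n (<⇒≤ i<j)))))

  other-neighbour : ∀ {B b} → 2 ≤ deg B b → ∀ a → ∃ λ j → j ∈ B × b ~ j × j ≢ a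
  other-neighbour 2≤deg a with pick 2 2≤deg
  ... | ys , ys-injective , ys∈ with ys zero ≟ a
  ... | no y₀≢a = let (y₀∈B , b~y₀) = ∈-∩⁻ (ys∈ zero) in ys zero , y₀∈B , b~y₀ , y₀≢a
  ... | yes y₀≡a = let (y₁∈B , b~y₁) = ∈-∩⁻ (ys∈ (suc zero)) in
    ys (suc zero) , y₁∈B , b~y₁ , λ y₁≡a → contradiction (ys-injective (trans y₁≡a (sym y₀≡a))) λ ()

  module _ {B : Subset n} (minDegree : ∀ {b} → b ∈ B → 2 ≤ deg B b) where

    record Arc : Set where
      field
        tail head : Fin n
        head∈B : head ∈ B
        tail~head : tail ~ head

    turn : (arc : Arc) → ∃ λ j → j ∈ B × Arc.head arc ~ j × j ≢ Arc.tail arc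
    turn arc = other-neighbour (minDegree (Arc.head∈B arc)) (Arc.tail arc)

    next : Arc → Arc
    next arc = record
      { tail = Arc.head arc
      ; head = proj₁ (turn arc)
      ; head∈B = proj₁ (proj₂ (turn arc))
      ; tail~head = proj₁ (proj₂ (proj₂ (turn arc)))
      }

    minDegree2⇒cycle : ∀ {b₀} → b₀ ∈ B → Cycle F
    minDegree2⇒cycle {b₀} b₀∈B = walk⇒cycle record
      { vertex = Arc.tail ∘ arcs
      ; adjacent = Arc.tail~head ∘ arcs
      ; non-backtracking = λ t → proj₂ (proj₂ (proj₂ (turn (arcs t))))
      }
      where
      first : Arc
      first = let (j , j∈B , b₀~j , _) = other-neighbour (minDegree b₀∈B) b₀ in
        record { tail = b₀ ; head = j ; head∈B = j∈B ; tail~head = b₀~j }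
      arcs : ℕ → Arc
      arcs zero    = first
      arcs (suc t) = next (arcs t)

  record ThreeLeaves (A : Subset n) : Set where
    field
      stem : Fin n
      stem∈ : stem ∈ A
      leaf : Fin 3 → Fin n
      leaf-injective : Injective _≡_ _≡_ leaf
      pendant : ∀ a → Pendant A (leaf a) stem

  module _ {A : Subset n} (forest : IsForest F) (degrees : DegreesOneMod3 A) where
    private
      big = fromDec (λ j → 2 ≤? deg A j)
      B = A ∩ big
      SmallNeighbours : Fin n → Subset n
      SmallNeighbours b = (A ∩ adj F b) ∩ ∁ big

      ∈B⁺ : ∀ {b} → b ∈ A → 2 ≤ deg A b → b ∈ B
      ∈B⁺ b∈A 2≤deg = ∈-∩⁺ b∈A (∈-fromDec⁺ {Q? = λ j → 2 ≤? deg A j} 2≤deg)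

      ∈B⁻ : ∀ {b} → b ∈ B → b ∈ A × 2 ≤ deg A b
      ∈B⁻ b∈B = let (b∈A , b∈big) = ∈-∩⁻ {P = A} {Q = big} b∈B in b∈A , ∈-fromDec⁻ {Q? = λ j → 2 ≤? deg A j} b∈big

      smallNeighbour⇒pendant : ∀ {b ℓ} → b ∈ A → ℓ ∈ SmallNeighbours b → Pendant A ℓ b
      smallNeighbour⇒pendant {b} {ℓ} b∈A ℓ∈ = record
        { leaf∈ = ℓ∈A ; adjacent = ~-sym b~ℓ
        ; unique = λ j∈A ℓ~j → size≡1⇒unique deg≡1 (∈-∩⁺ b∈A (~-sym b~ℓ)) (∈-∩⁺ j∈A ℓ~j) }
        where
        ℓ∈A∩ = proj₁ (∈-∩⁻ ℓ∈)
        ℓ∈A = proj₁ (∈-∩⁻ ℓ∈A∩)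
        b~ℓ = proj₂ (∈-∩⁻ ℓ∈A∩)
        deg≡1 : deg A ℓ ≡ 1
        deg≡1 = ≡1-mod-3∧<2⇒≡1 (degrees ℓ∈A) (∈-∁⁻ (proj₂ (∈-∩⁻ ℓ∈)) ∘ ∈-fromDec⁺ {Q? = λ j → 2 ≤? deg A j})

      3≤leaves : ∀ {b} → b ∈ B → ¬ 2 ≤ deg B b → 3 ≤ size (SmallNeighbours b)
      3≤leaves {b} b∈B 2≰deg = ≤-pred (≤-trans (subst (4 ≤_) deg-split 4≤deg) (+-monoˡ-≤ _ (≤-pred (≰⇒> 2≰deg))))
        where
        4≤deg : 4 ≤ deg A b
        4≤deg = ≡1-mod-3∧≥2⇒≥4 (degrees (proj₁ (∈B⁻ b∈B))) (proj₂ (∈B⁻ b∈B))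
        deg-split : deg A b ≡ deg B b + size (SmallNeighbours b)
        deg-split = trans (∑⟨⟩-partition big) (cong (_+ size (SmallNeighbours b)) (∑⟨⟩-congˡ λ j →
          trans (∧-assoc (A j) _ _) (trans (cong (A j ∧_) (∧-comm (adj F b j) _)) (sym (∧-assoc (A j) _ _)))))

      leavesAt : ∀ {b} → b ∈ B →
                 Σ (Fin 3 → Fin n) (λ ℓ → Injective _≡_ _≡_ ℓ × (∀ a → ℓ a ∈ SmallNeighbours b)) → ThreeLeaves A
      leavesAt {b} b∈B (ℓ , ℓ-injective , ℓ∈) = record
        { stem = b ; stem∈ = proj₁ (∈B⁻ b∈B) ; leaf = ℓ ; leaf-injective = ℓ-injective
        ; pendant = λ a → smallNeighbour⇒pendant (proj₁ (∈B⁻ b∈B)) (ℓ∈ a) }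

    -- If every vertex of degree at least 2 had two neighbours of degree at least 2, these vertices
    -- would induce a subgraph of minimum degree 2, hence a cycle; so some vertex of degree at
    -- least 4 has at least three neighbours of degree 1.
    threeLeaves : i ∈ A → 2 ≤ deg A i → ThreeLeaves A
    threeLeaves i₀∈A 2≤deg with any? (λ b → (b ∈? B) ×-dec ¬? (2 ≤? deg B b))
    ... | no ∄ = contradiction (minDegree2⇒cycle minDegree (∈B⁺ i₀∈A 2≤deg)) forest
      where
      minDegree : ∀ {b} → b ∈ B → 2 ≤ deg B b
      minDegree {b} b∈B = decidable-stable (2 ≤? deg B b) λ 2≰deg → ∄ (b , b∈B , 2≰deg)
    ... | yes (b , b∈B , 2≰deg) = leavesAt b∈B (pick 3 (3≤leaves b∈B 2≰deg))

  PerfectMatching : Subset n → Set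
  PerfectMatching A = ∀ {i} → i ∈ A → deg A i ≡ 1

  module _ {A : Subset n} (perfect : PerfectMatching A) where

    partner : x ∈ A → ∃ λ p → p ∈ A × x ~ p
    partner x∈A = let (p , p∈A∩) = size-nonempty (subst (0 <_) (sym (perfect x∈A)) (s≤s z≤n)) in p , ∈-∩⁻ p∈A∩

    perfect⇒pendant : x ∈ A → p ∈ A → x ~ p → Pendant A x p
    perfect⇒pendant x∈A p∈A x~p = record
      { leaf∈ = x∈A ; adjacent = x~p
      ; unique = λ j∈A x~j → size≡1⇒unique (perfect x∈A) (∈-∩⁺ p∈A x~p) (∈-∩⁺ j∈A x~j) }

    size≢1 : size A ≢ 1
    size≢1 size≡1 = let (x , x∈A) = size-nonempty (subst (0 <_) (sym size≡1) (s≤s z≤n)) ; (p , p∈A , x~p) = partner x∈A in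
      ~⇒≢ x~p (sym (size≡1⇒unique size≡1 x∈A p∈A))

    module _ {u v} (u∈A : u ∈ A) (v∈A : v ∈ A) (u~v : u ~ v) where

      private
        v∈A─u = ∈-─⁺ v∈A (~⇒≢ u~v ∘ sym)

      size-─edge : size A ≡ 2 + size (A ─ u ─ v)
      size-─edge = trans (size-remove u∈A) (cong suc (size-remove v∈A─u))

      perfect-─edge : PerfectMatching (A ─ u ─ v)
      perfect-─edge {i} i∈A─u─v = trans (sym deg-unchanged) (perfect i∈A)
        where
        i∈A─u = proj₁ (∈-─⁻ i∈A─u─v)
        i∈A = proj₁ (∈-─⁻ i∈A─u)
        ¬i~u : ¬ i ~ u
        ¬i~u i~u = proj₂ (∈-─⁻ i∈A─u─v) (Pendant.unique (perfect⇒pendant u∈A v∈A u~v) i∈A (~-sym i~u))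
        ¬i~v : ¬ i ~ v
        ¬i~v i~v = proj₂ (∈-─⁻ i∈A─u) (Pendant.unique (perfect⇒pendant v∈A u∈A (~-sym u~v)) i∈A (~-sym i~v))
        deg-unchanged : deg A i ≡ deg (A ─ u ─ v) i
        deg-unchanged = trans (deg-─ u∈A)
          (cong₂ _+_ (if-∉ ¬i~u) (trans (deg-─ v∈A─u) (cong (_+ deg (A ─ u ─ v) i) (if-∉ ¬i~v))))

  size≢3 : PerfectMatching A → size A ≢ 3
  size≢3 {A} perfect size≡3 = size≢1 (perfect-─edge perfect u∈A v∈A u~v)
    (suc-injective (suc-injective (trans (sym (size-─edge perfect u∈A v∈A u~v)) size≡3)))
    where
    nonempty = size-nonempty {P = A} (subst (0 <_) (sym size≡3) (s≤s z≤n))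
    u∈A = proj₂ nonempty
    matched = partner perfect u∈A
    v∈A = proj₁ (proj₂ matched)
    u~v = proj₂ (proj₂ matched)

  record DisjointEdges (A : Subset n) (k : ℕ) : Set where
    field
      left right : Fin k → Fin n
      left-injective : Injective _≡_ _≡_ left
      right-injective : Injective _≡_ _≡_ right
      left≢right : ∀ a b → left a ≢ right b
      left∈ : ∀ a → left a ∈ A
      right∈ : ∀ a → right a ∈ A
      left~right : ∀ a → left a ~ right a

  disjointEdges : PerfectMatching A → k + k ≤ size A → DisjointEdges A k
  disjointEdges {k = zero} _ _ = record
    { left = λ () ; right = λ () ; left-injective = λ { {()} } ; right-injective = λ { {()} }
    ; left≢right = λ () ; left∈ = λ () ; right∈ = λ () ; left~right = λ () }
  disjointEdges {A} {suc k} perfect room = record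
    { left = u Vector.∷ left
    ; right = v Vector.∷ right
    ; left-injective = ∷-injective (λ a → proj₁ (≢u&≢v (left∈ a))) left-injective
    ; right-injective = ∷-injective (λ a → proj₂ (≢u&≢v (right∈ a))) right-injective
    ; left≢right = λ where
        zero    zero    → ~⇒≢ u~v
        zero    (suc b) → proj₁ (≢u&≢v (right∈ b)) ∘ sym
        (suc a) zero    → proj₂ (≢u&≢v (left∈ a))
        (suc a) (suc b) → left≢right a b
    ; left∈ = λ { zero → u∈A ; (suc a) → ⊆A (left∈ a) }
    ; right∈ = λ { zero → v∈A ; (suc a) → ⊆A (right∈ a) }
    ; left~right = λ { zero → u~v ; (suc a) → left~right a }
    }
    where
    nonempty = size-nonempty (≤-trans (s≤s z≤n) room)
    u = proj₁ nonempty
    u∈A = proj₂ nonempty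
    matched = partner perfect u∈A
    v = proj₁ matched
    v∈A = proj₁ (proj₂ matched)
    u~v = proj₂ (proj₂ matched)
    room′ : k + k ≤ size (A ─ u ─ v)
    room′ = ≤-pred (≤-pred (subst (suc (suc (k + k)) ≤_) (size-─edge perfect u∈A v∈A u~v)
                                  (subst (_≤ size A) (+-suc (suc k) k) room)))
    open DisjointEdges (disjointEdges {k = k} (perfect-─edge perfect u∈A v∈A u~v) room′)
    ≢u&≢v : i ∈ A ─ u ─ v → i ≢ u × i ≢ v
    ≢u&≢v i∈A─u─v = proj₂ (∈-─⁻ (proj₁ (∈-─⁻ i∈A─u─v))) , proj₂ (∈-─⁻ i∈A─u─v)
    ⊆A : i ∈ A ─ u ─ v → i ∈ A
    ⊆A i∈A─u─v = proj₁ (∈-─⁻ (proj₁ (∈-─⁻ i∈A─u─v)))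

  module _ {A : Subset n} (L : ThreeLeaves A) where
    open ThreeLeaves L

    leaf∈ : ∀ a → leaf a ∈ A
    leaf∈ a = Pendant.leaf∈ (pendant a)

    stem∈A∖leaf : stem ∈ A ∖ leaf
    stem∈A∖leaf = ∈-∖⁺ stem∈ λ a → ~⇒≢ (Pendant.adjacent (pendant a)) ∘ sym

    size-∖leaf : size A ≡ 3 + size (A ∖ leaf)
    size-∖leaf = size-∖ leaf-injective leaf∈

    degrees-∖leaf : DegreesOneMod3 A → DegreesOneMod3 (A ∖ leaf)
    degrees-∖leaf degrees {i} i∈A∖leaf with i ≟ stem
    ... | yes refl = trans (sym ([m+n]%n≡m%n (deg (A ∖ leaf) stem) 3))
                           (trans (cong (_% 3) (trans (+-comm _ 3) (sym at-stem))) (degrees stem∈))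
      where
      at-stem : deg A stem ≡ 3 + deg (A ∖ leaf) stem
      at-stem = deg-∖-adjacent leaf-injective leaf∈ λ a → ~-sym (Pendant.adjacent (pendant a))
    ... | no i≢stem = trans (cong (_% 3) (sym elsewhere)) (degrees i∈A)
      where
      i∈A = proj₁ (∈-∖⁻ {xs = leaf} i∈A∖leaf)
      elsewhere : deg A i ≡ deg (A ∖ leaf) i
      elsewhere = deg-∖-nonadjacent leaf-injective leaf∈ λ a i~leaf → i≢stem (Pendant.unique (pendant a) i∈A (~-sym i~leaf))

  module _ {A : Subset n} (perfect : PerfectMatching A) (M : DisjointEdges A k) where
    open DisjointEdges M

    right∈A∖left : ∀ a → right a ∈ A ∖ left
    right∈A∖left a = ∈-∖⁺ (right∈ a) λ b → left≢right b a ∘ sym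

    size-∖edges : size A ≡ k + (k + size ((A ∖ left) ∖ right))
    size-∖edges = trans (size-∖ left-injective left∈) (cong (k +_) (size-∖ right-injective right∈A∖left))

    left-pendant : ∀ a → Pendant A (left a) (right a)
    left-pendant a = perfect⇒pendant perfect (left∈ a) (right∈ a) (left~right a)

    right-isolated : ∀ a {j} → j ∈ A ∖ left → ¬ right a ~ j
    right-isolated a {j} j∈A∖left right~j = proj₂ (∈-∖⁻ {xs = left} j∈A∖left) a (Pendant.unique right-pendant j∈A right~j)
      where
      j∈A = proj₁ (∈-∖⁻ {xs = left} j∈A∖left)
      right-pendant = perfect⇒pendant perfect (right∈ a) (left∈ a) (~-sym (left~right a))

    perfect-∖edges : PerfectMatching ((A ∖ left) ∖ right)
    perfect-∖edges {i} i∈A″ = trans (sym (trans unchanged-by-left unchanged-by-right)) (perfect i∈A)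
      where
      i∈A∖left = proj₁ (∈-∖⁻ {xs = right} i∈A″)
      i∈A = proj₁ (∈-∖⁻ {xs = left} i∈A∖left)
      unchanged-by-left : deg A i ≡ deg (A ∖ left) i
      unchanged-by-left = deg-∖-nonadjacent left-injective left∈ λ a i~left →
        proj₂ (∈-∖⁻ {xs = right} i∈A″) a (Pendant.unique (left-pendant a) i∈A (~-sym i~left))
      unchanged-by-right : deg (A ∖ left) i ≡ deg ((A ∖ left) ∖ right) i
      unchanged-by-right = deg-∖-nonadjacent right-injective right∈A∖left λ a i~right → right-isolated a i∈A∖left (~-sym i~right)

module _ {n N} (F : Graph n) (χ : Colouring N) where

  record Embedding (A : Subset n) : Set where
    field
      φ : Fin n → Fin N
      free : Subset N
      size-free : size A + size free ≡ N
      injective : ∀ {i j} → i ∈ A → j ∈ A → φ i ≡ φ j → i ≡ j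
      used : ∀ {i} → i ∈ A → φ i ∉ free

  open Embedding

  ZeroSum : (A : Subset n) → Embedding A → Set
  ZeroSum A e = 3 ∣ arcSum F A (colourWeight χ (φ e))

  record Extension {A : Subset n} {k} (xs : Fin k → Fin n) (e : Embedding (A ∖ xs)) (ys : Fin k → Fin N) : Set where
    field
      embedding : Embedding A
      at-new : ∀ a → φ embedding (xs a) ≡ ys a
      at-old : ∀ {i} → i ∈ A ∖ xs → φ embedding i ≡ φ e i
      free-kept : ∀ {y} → y ∈ free e → (∀ a → y ≢ ys a) → y ∈ free embedding

  extend₁ : ∀ {A x y} → x ∈ A → (e : Embedding (A ─ x)) → y ∈ free e → Embedding A
  extend₁ {A} {x} {y} x∈A e y∈free = record
    { φ = φ′
    ; free = free e ─ y
    ; size-free = begin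
        size A + size (free e ─ y)          ≡⟨ cong (_+ size (free e ─ y)) (size-remove x∈A) ⟩
        suc (size (A ─ x)) + size (free e ─ y) ≡⟨ +-suc (size (A ─ x)) _ ⟨
        size (A ─ x) + suc (size (free e ─ y)) ≡⟨ cong (size (A ─ x) +_) (size-remove y∈free) ⟨
        size (A ─ x) + size (free e)        ≡⟨ size-free e ⟩
        N                                   ∎
    ; injective = injective′
    ; used = used′
    }
    where
    open ≡-Reasoning
    φ′ = updateAt (φ e) x (λ _ → y)
    φ′-elsewhere : ∀ {i} → i ≢ x → φ′ i ≡ φ e i
    φ′-elsewhere {i} i≢x = updateAt-minimal i x (φ e) i≢x
    y≢old : ∀ {j} → j ∈ A → j ≢ x → y ≢ φ e j
    y≢old j∈A j≢x y≡φj = used e (∈-─⁺ j∈A j≢x) (subst (_∈ free e) y≡φj y∈free)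
    injective′ : ∀ {i j} → i ∈ A → j ∈ A → φ′ i ≡ φ′ j → i ≡ j
    injective′ {i} {j} i∈A j∈A eq with i ≟ x | j ≟ x
    ... | yes refl | yes refl = refl
    ... | yes refl | no j≢x   = contradiction (trans (sym (updateAt-updates x (φ e))) (trans eq (φ′-elsewhere j≢x)))
                                              (y≢old j∈A j≢x)
    ... | no i≢x   | yes refl = contradiction (trans (sym (updateAt-updates x (φ e))) (trans (sym eq) (φ′-elsewhere i≢x)))
                                              (y≢old i∈A i≢x)
    ... | no i≢x   | no j≢x   = injective e (∈-─⁺ i∈A i≢x) (∈-─⁺ j∈A j≢x)
                                            (trans (sym (φ′-elsewhere i≢x)) (trans eq (φ′-elsewhere j≢x)))
    used′ : ∀ {i} → i ∈ A → φ′ i ∉ free e ─ y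
    used′ {i} i∈A with i ≟ x
    ... | yes refl = subst (_∉ free e ─ y) (sym (updateAt-updates x (φ e))) (x∉P─x (free e) y)
    ... | no i≢x   = λ φ′i∈ → used e (∈-─⁺ i∈A i≢x)
                                     (proj₁ (∈-─⁻ (subst (_∈ free e ─ y) (φ′-elsewhere i≢x) φ′i∈)))

  opaque
    unfolding _∖_

    extend : ∀ {A : Subset n} {k} {xs : Fin k → Fin n} → Injective _≡_ _≡_ xs → (∀ a → xs a ∈ A) →
             (e : Embedding (A ∖ xs)) {ys : Fin k → Fin N} → Injective _≡_ _≡_ ys → (∀ a → ys a ∈ free e) →
             Extension xs e ys
    extend {k = zero} _ _ e _ _ = record { embedding = e ; at-new = λ () ; at-old = λ _ → refl ; free-kept = λ y∈free _ → y∈free }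
    extend {A} {suc k} {xs} xs-injective xs∈A e {ys} ys-injective ys∈free = record
      { embedding = extend₁ (xs∈A zero) embedding y₀∈free
      ; at-new = λ where
          zero    → updateAt-updates (xs zero) (φ embedding)
          (suc a) → trans (updateAt-minimal _ _ (φ embedding) (xs-distinct a)) (at-new a)
      ; at-old = λ {i} i∈A∖xs →
          trans (updateAt-minimal i _ (φ embedding) (proj₂ (∈-∖⁻ {xs = xs} i∈A∖xs) zero)) (at-old i∈A∖xs)
      ; free-kept = λ y∈free y≢ys → ∈-─⁺ (free-kept y∈free (y≢ys ∘ suc)) (y≢ys zero)
      }
      where
      open Extension (extend (Fin.suc-injective ∘ xs-injective) (tail∈─head xs-injective xs∈A) e
                             (Fin.suc-injective ∘ ys-injective) (ys∈free ∘ suc))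
      xs-distinct : ∀ a → xs (suc a) ≢ xs zero
      xs-distinct a eq = contradiction (xs-injective eq) λ ()
      y₀∈free : ys zero ∈ free embedding
      y₀∈free = free-kept (ys∈free zero) λ a eq → contradiction (ys-injective eq) λ ()

  free-room : ∀ {A r} (e : Embedding A) → r + size A ≤ N → r ≤ size (free e)
  free-room {A} {r} e room = +-cancelʳ-≤ (size A) r _ (subst (r + size A ≤_) (trans (sym (size-free e)) (+-comm (size A) _)) room)

  private
    colourOf : Fin N → Fin N → ℕ
    colourOf u v = toℕ (col χ u v)

  module _ {A : Subset n} (L : ThreeLeaves F A) where
    open ThreeLeaves L

    leafExtension-zeroSum : ∀ {e : Embedding (A ∖ leaf)} {ys} (ext : Extension leaf e ys) →
                            3 ∣ ∑[ a < 3 ] colourOf (φ e stem) (ys a) → ZeroSum _ e → ZeroSum A (Extension.embedding ext)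
    leafExtension-zeroSum {e} {ys} ext 3∣∑ zero-sum =
      subst (3 ∣_) (sym decomposition) (∣m∣n⇒∣m+n (∣m∣n⇒∣m+n 3∣∑ 3∣∑) zero-sum)
      where
      open Extension ext
      c : Fin 3 → ℕ
      c a = colourOf (φ e stem) (ys a)
      stem↦ = at-old (stem∈A∖leaf F L)
      contribution : ∀ a → colourOf (φ embedding (leaf a)) (φ embedding stem) + colourOf (φ embedding stem) (φ embedding (leaf a))
                           ≡ c a + c a
      contribution a = cong₂ _+_ (trans (cong₂ colourOf (at-new a) stem↦) (cong toℕ (colSym χ (ys a) (φ e stem))))
                                 (cong₂ colourOf stem↦ (at-new a))
      decomposition : arcSum F A (colourWeight χ (φ embedding))
                      ≡ (∑[ a < 3 ] c a + ∑[ a < 3 ] c a) + arcSum F (A ∖ leaf) (colourWeight χ (φ e))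
      decomposition = begin
        arcSum F A (colourWeight χ (φ embedding))
          ≡⟨ arcSum-∖-pendants F leaf-injective pendant (λ _ → stem∈A∖leaf F L) ⟩
        ∑[ a < 3 ] (colourOf (φ embedding (leaf a)) (φ embedding stem) + colourOf (φ embedding stem) (φ embedding (leaf a)))
          + arcSum F (A ∖ leaf) (colourWeight χ (φ embedding))
          ≡⟨ cong₂ _+_ (trans (sum-cong-≗ contribution) (∑-distrib-+ c c))
                       (arcSum-cong F λ i∈ j∈ → cong₂ colourOf (at-old i∈) (at-old j∈)) ⟩
        (∑[ a < 3 ] c a + ∑[ a < 3 ] c a) + arcSum F (A ∖ leaf) (colourWeight χ (φ e))
          ∎
        where open ≡-Reasoning

    extendAtLeaves : size A + 2 ≤ N → (e : Embedding (A ∖ leaf)) → ZeroSum _ e → Σ (Embedding A) (ZeroSum A)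
    extendAtLeaves room e zero-sum = Extension.embedding ext , leafExtension-zeroSum ext (proj₂ (proj₂ triple)) zero-sum
      where
      5≤free : 5 ≤ size (free e)
      5≤free = free-room e (subst (_≤ N) (trans (+-comm (size A) 2) (cong (2 +_) (size-∖leaf F L))) room)
      picked = pick 5 5≤free
      z = proj₁ picked
      triple = zeroSumTriple (λ a → col χ (φ e stem) (z a))
      ext = extend leaf-injective (leaf∈ F L) e (proj₁ (proj₂ triple) ∘ proj₁ (proj₂ picked))
                                                 (proj₂ (proj₂ picked) ∘ proj₁ triple)

  module _ {A : Subset n} (perfect : PerfectMatching F A) (M : DisjointEdges F A 3) where
    open DisjointEdges M

    edgeExtension-zeroSum : ∀ {e : Embedding ((A ∖ left) ∖ right)} {ysl ysr}
                            (ext₁ : Extension right e ysr) (ext₂ : Extension left (Extension.embedding ext₁) ysl) →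
                            3 ∣ ∑[ a < 3 ] colourOf (ysl a) (ysr a) → ZeroSum _ e → ZeroSum A (Extension.embedding ext₂)
    edgeExtension-zeroSum {e} {ysl} {ysr} ext₁ ext₂ 3∣∑ zero-sum =
      subst (3 ∣_) (sym decomposition) (∣m∣n⇒∣m+n (∣m∣n⇒∣m+n 3∣∑ 3∣∑) zero-sum)
      where
      ψ = φ (Extension.embedding ext₂)
      c : Fin 3 → ℕ
      c a = colourOf (ysl a) (ysr a)
      at-left : ∀ a → ψ (left a) ≡ ysl a
      at-left = Extension.at-new ext₂
      at-right : ∀ a → ψ (right a) ≡ ysr a
      at-right a = trans (Extension.at-old ext₂ (right∈A∖left F perfect M a)) (Extension.at-new ext₁ a)
      at-rest : ∀ {i} → i ∈ (A ∖ left) ∖ right → ψ i ≡ φ e i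
      at-rest i∈ = trans (Extension.at-old ext₂ (proj₁ (∈-∖⁻ {xs = right} i∈))) (Extension.at-old ext₁ i∈)
      contribution : ∀ a → colourOf (ψ (left a)) (ψ (right a)) + colourOf (ψ (right a)) (ψ (left a)) ≡ c a + c a
      contribution a = cong₂ _+_ (cong₂ colourOf (at-left a) (at-right a))
                                 (trans (cong₂ colourOf (at-right a) (at-left a)) (cong toℕ (colSym χ (ysr a) (ysl a))))
      decomposition : arcSum F A (colourWeight χ ψ)
                      ≡ (∑[ a < 3 ] c a + ∑[ a < 3 ] c a) + arcSum F ((A ∖ left) ∖ right) (colourWeight χ (φ e))
      decomposition = begin
        arcSum F A (colourWeight χ ψ)
          ≡⟨ arcSum-∖-pendants F left-injective (left-pendant F perfect M) (right∈A∖left F perfect M) ⟩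
        ∑[ a < 3 ] (colourOf (ψ (left a)) (ψ (right a)) + colourOf (ψ (right a)) (ψ (left a))) + arcSum F (A ∖ left) (colourWeight χ ψ)
          ≡⟨ cong₂ _+_ (trans (sum-cong-≗ contribution) (∑-distrib-+ c c))
                       (trans (arcSum-∖-isolated F right-injective (right∈A∖left F perfect M) (right-isolated F perfect M))
                              (arcSum-cong F λ i∈ j∈ → cong₂ colourOf (at-rest i∈) (at-rest j∈))) ⟩
        (∑[ a < 3 ] c a + ∑[ a < 3 ] c a) + arcSum F ((A ∖ left) ∖ right) (colourWeight χ (φ e))
          ∎
        where open ≡-Reasoning

    extendAtEdges : size A + 2 ≤ N → (e : Embedding ((A ∖ left) ∖ right)) → ZeroSum _ e → Σ (Embedding A) (ZeroSum A)
    extendAtEdges room e zero-sum =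
      Extension.embedding ext₂ , edgeExtension-zeroSum ext₁ ext₂ (ZeroSumMatching.zero-sum matching) zero-sum
      where
      8≤free : 8 ≤ size (free e)
      8≤free = free-room e (subst (_≤ N) (trans (+-comm (size A) 2) (cong (2 +_) (size-∖edges F perfect M))) room)
      picked = pick 8 8≤free
      z = proj₁ picked
      z-injective = proj₁ (proj₂ picked)
      z∈free = proj₂ (proj₂ picked)
      matching = zeroSumMatching (λ a b → col χ (z a) (z b))
      open ZeroSumMatching matching using ()
        renaming (left to l; right to r; left-injective to l-injective; right-injective to r-injective; left≢right to l≢r)
      ext₁ = extend {A = A ∖ left} {xs = right} right-injective (right∈A∖left F perfect M) e
                    (r-injective ∘ z-injective) (z∈free ∘ r)
      ext₂ = extend {A = A} {xs = left} left-injective left∈ (Extension.embedding ext₁) (l-injective ∘ z-injective)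
                    (λ a → Extension.free-kept ext₁ (z∈free (l a)) λ b eq → l≢r a b (z-injective eq))

  emptyEmbedding : ∀ {A} → size A ≡ 0 → size A + 2 ≤ N → Σ (Embedding A) (ZeroSum A)
  emptyEmbedding {A} size≡0 room = record
    { φ = λ _ → fromℕ< (≤-trans (s≤s z≤n) (≤-trans (m≤n+m 2 (size A)) room))
    ; free = full
    ; size-free = trans (cong (_+ size full) size≡0) size-full
    ; injective = λ i∈A → contradiction i∈A (empty _)
    ; used = λ i∈A → contradiction i∈A (empty _)
    } , subst (3 ∣_) (sym (∑⟨⟩-empty empty)) (3 ∣0)
    where
    empty = size≡0⇒empty size≡0

  module _ (forest : IsForest F) where

    Embeddable : Subset n → Set
    Embeddable A = 3 ∣ size A → DegreesOneMod3 F A → size A + 2 ≤ N → Σ (Embedding A) (ZeroSum A)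

    leavesCase : ∀ {A} → (∀ {A′} → size A′ < size A → Embeddable A′) → (L : ThreeLeaves F A) → Embeddable A
    leavesCase {A} smaller L 3∣size degrees room =
      extendAtLeaves L room (proj₁ rest) (proj₂ rest)
      where
      open ThreeLeaves L
      size≡ = size-∖leaf F L
      rest = smaller (subst (size (A ∖ leaf) <_) (sym size≡) (s≤s (m≤n+m _ 2)))
                     (∣m+n∣m⇒∣n (subst (3 ∣_) size≡ 3∣size) (divides 1 refl))
                     (degrees-∖leaf F L degrees)
                     (≤-trans (+-monoˡ-≤ 2 (subst (size (A ∖ leaf) ≤_) (sym size≡) (m≤n+m _ 3))) room)

    edgesCase : ∀ {A} → (∀ {A′} → size A′ < size A → Embeddable A′) → (perfect : PerfectMatching F A) →
                6 ≤ size A → Embeddable A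
    edgesCase {A} smaller perfect 6≤size 3∣size _ room =
      extendAtEdges perfect M room (proj₁ rest) (proj₂ rest)
      where
      M = disjointEdges F perfect 6≤size
      open DisjointEdges M
      size≡ = size-∖edges F perfect M
      rest = smaller (subst (size ((A ∖ left) ∖ right) <_) (sym size≡) (s≤s (m≤n+m _ 5)))
                     (∣m+n∣m⇒∣n (subst (3 ∣_) size≡ 3∣size) (divides 2 refl))
                     (λ i∈ → cong (_% 3) (perfect-∖edges F perfect M i∈))
                     (≤-trans (+-monoˡ-≤ 2 (subst (size ((A ∖ left) ∖ right) ≤_) (sym size≡) (m≤n+m _ 6))) room)

    embed : ∀ A → Embeddable A
    embed A = <-rec (λ s → ∀ A → size A ≡ s → Embeddable A) step (size A) A refl
      where
      step : ∀ s → (∀ {s′} → s′ < s → ∀ A → size A ≡ s′ → Embeddable A) → ∀ A → size A ≡ s → Embeddable A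
      step _ rec A refl 3∣size degrees room with 3∣⇒0∨3∨≥6 3∣size | any? (λ i → (i ∈? A) ×-dec (2 ≤? deg F A i))
      ... | inj₁ size≡0 | _ = emptyEmbedding size≡0 room
      ... | inj₂ _ | yes (i , i∈A , 2≤deg) = leavesCase smaller (threeLeaves F forest degrees i∈A 2≤deg) 3∣size degrees room
        where smaller = λ {A′} size< → rec size< A′ refl
      ... | inj₂ (inj₁ size≡3) | no ∄ = contradiction size≡3 (size≢3 F perfect)
        where perfect = λ {i} i∈A → ≡1-mod-3∧<2⇒≡1 (degrees i∈A) λ 2≤deg → ∄ (i , i∈A , 2≤deg)
      ... | inj₂ (inj₂ 6≤size) | no ∄ = edgesCase smaller perfect 6≤size 3∣size degrees room
        where
        smaller = λ {A′} size< → rec size< A′ refl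
        perfect = λ {i} i∈A → ≡1-mod-3∧<2⇒≡1 (degrees i∈A) λ 2≤deg → ∄ (i , i∈A , 2≤deg)

-- The argument covers matchings as well.
proposition4p2 : (n : ℕ) (F : Graph n) → IsForest F
    → (∀ (v : Fin n) → degree F v % 3 ≡ 1)
    → 3 ∣ e F
    → ¬ IsMatching F
    → RZ3≤ F (n + 2)
proposition4p2 n F forest degrees 3∣e _ = n + 2 , ≤-refl , λ χ →
  let (embedding , zero-sum) = embed F χ forest full 3∣size degrees-full room in
  Embedding.φ embedding , Embedding.injective embedding ∈-full ∈-full , copySum≡0 F χ (Embedding.φ embedding) zero-sum
  where
  3∣size : 3 ∣ size (full {n})
  3∣size = subst (3 ∣_) (sym size-full) (3∣vertices F degrees 3∣e)
  degrees-full : DegreesOneMod3 F full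
  degrees-full {i} _ = trans (cong (_% 3) (sym (degree≡deg F i))) (degrees i)
  room : size (full {n}) + 2 ≤ n + 2
  room = ≤-reflexive (cong (_+ 2) size-full)
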